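{- Let $\sigma$ be a non-empty permutation. If a permutation $\phi$ is $\sigma$-narrow with a $\sigma$-core $\phi^-$, and if $\sigma$ has no interval copy of $\phi$ nor of $\phi^-$, then $\phi$ is a $\sigma$-annihilator.
   Context: Permutations (including the empty permutation $\epsilon$) are ordered by containment: $\sigma\le\pi$ if $\pi$ has a subsequence order-isomorphic to $\sigma$. For permutations $\sigma,\pi$, $[\sigma,\pi]=\{\tau:\sigma\le\tau\le\pi\}$ and $[\sigma,\pi)=\{\tau:\sigma\le\tau<\pi\}$. The Möbius function: $\mu[\sigma,\pi]=0$ if $\sigma\not\le\pi$, $\mu[\sigma,\pi]=1$ if $\sigma=\pi$, and $\mu[\sigma,\pi]=-\sum_{\tau\in[\sigma,\pi)}\mu[\sigma,\tau]$ otherwise. An interval of a permutation is a non-empty set of contiguous positions whose values form a set of consecutive integers; $\pi$ has an interval copy of $\phi$ if it has an interval of length $|\phi|$ whose entries are order-isomorphic to $\phi$. A permutation $\pi$ is a $\sigma$-zero if $\mu[\sigma,\pi]=0$; $\phi$ is a $\sigma$-annihilator if every permutation having an interval copy of $\phi$ is a $\sigma$-zero. A permutation $\phi$ is $\sigma$-narrow if $\phi$ contains a permutation $\phi^-$ of length $|\phi|-1$ such that every permutation in $[1,\phi)\setminus[1,\phi^-]$ is a $\sigma$-annihilator ($1$ denotes the permutation of length one); such $\phi^-$ is called a $\sigma$-core of $\phi$. -}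

module Defs where

open import Data.Nat using (ℕ; zero; suc; _+_; _<_; _<?_; _≤_)
open import Data.Nat.Properties using (_≟_)
open import Data.Integer as ℤ using (ℤ; 0ℤ; 1ℤ; -_)
open import Data.List using (List; []; _∷_; length; map; filter; upTo; deduplicate; foldr; take; drop)
open import Data.List.Properties using (≡-dec)
open import Data.List.Membership.Propositional using (_∈_)
open import Data.List.Membership.DecPropositional (≡-dec _≟_) using (_∈?_)
open import Data.List.Relation.Binary.Permutation.Propositional using (_↭_)
open import Data.Product using (Σ; ∃; _×_)
open import Relation.Binary.PropositionalEquality using (_≡_; _≢_)
open import Relation.Nullary using (¬_; yes; no)

-- A permutation of length n is a list of the values 1..n (one-line notation).
-- The empty list is the empty permutation ε.
IsPerm : List ℕ → Set
IsPerm π = π ↭ map suc (upTo (length π))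

one : List ℕ
one = 1 ∷ []

std : List ℕ → List ℕ
std s = map (λ x → suc (length (filter (_<? x) s))) s

subs : List ℕ → List (List ℕ)
subs [] = [] ∷ []
subs (x ∷ xs) = map (x ∷_) (subs xs) Data.List.++ subs xs

patterns : List ℕ → List (List ℕ)
patterns π = map std (subs π)

_≼_ : List ℕ → List ℕ → Set
σ ≼ π = σ ∈ patterns π

_≺_ : List ℕ → List ℕ → Set
σ ≺ π = σ ≼ π × σ ≢ π

-- Patterns of proper subsequences (these are exactly the τ with τ < π).
properPatterns : List ℕ → List (List ℕ)
properPatterns π = map std (filter (λ s → length s <? length π) (subs π))

sumℤ : List ℤ → ℤ
sumℤ = foldr ℤ._+_ 0ℤ

-- Möbius function, computed by the defining recursion; the fuel argument
-- bounds recursion depth (lengths strictly decrease), and fuel suc |π| suffices.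
μF : ℕ → List ℕ → List ℕ → ℤ
μF zero σ π = 0ℤ
μF (suc k) σ π with ≡-dec _≟_ σ π
... | yes _ = 1ℤ
... | no _ with σ ∈? patterns π
...   | no _ = 0ℤ
...   | yes _ = - sumℤ (map (μF k σ)
                   (deduplicate (≡-dec _≟_)
                     (filter (λ τ → σ ∈? patterns τ) (properPatterns π))))

μ : List ℕ → List ℕ → ℤ
μ σ π = μF (suc (length π)) σ π

IsZero : List ℕ → List ℕ → Set
IsZero σ π = μ σ π ≡ 0ℤ

Consecutive : List ℕ → Set
Consecutive s = ∃ λ a → s ↭ map (a +_) (upTo (length s))

HasIntervalCopy : List ℕ → List ℕ → Set
HasIntervalCopy π φ =
  1 ≤ length φ × (∃ λ i →
    let s = take (length φ) (drop i π) in
    length s ≡ length φ × Consecutive s × std s ≡ φ)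

Annihilator : List ℕ → List ℕ → Set
Annihilator σ φ = ∀ π → IsPerm π → HasIntervalCopy π φ → IsZero σ π

IsCore : List ℕ → List ℕ → List ℕ → Set
IsCore σ φ φ⁻ =
  IsPerm φ⁻ × suc (length φ⁻) ≡ length φ × φ⁻ ≼ φ ×
  (∀ τ → IsPerm τ → one ≼ τ → τ ≺ φ → ¬ (one ≼ τ × τ ≼ φ⁻) → Annihilator σ τ)

Narrow : List ℕ → List ℕ → Set
Narrow σ φ = ∃ λ φ⁻ → IsCore σ φ φ⁻

module Submission where

-- Let π have an interval copy w of φ, and let π⁻ be π with w shrunk
-- to an occurrence of φ⁻ inside w. Every τ ∈ [σ, π) not contained in π⁻ uses, in
-- the window of w, either all of w (so τ has an interval copy of φ and is shorter
-- than π: induction on |π|) or a part whose pattern ψ lies in [1, φ) ∖ [1, φ⁻]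
-- (so τ has an interval copy of the annihilator ψ). Thus in the recursion for
-- μ[σ, π] only the terms of [σ, π⁻] survive, and these sum to zero as σ ≠ π⁻.

open import Defs
open import Data.Nat using (ℕ; suc; _+_; _<_; _≤_; _<?_; z≤n; s≤s)
open import Data.Nat.Properties
open import Data.Nat.Tactic.RingSolver using (solve-∀)
open import Data.Integer as ℤ using (ℤ; 0ℤ; -_)
import Data.Integer.Properties as ℤP
open import Data.Product using (∃; ∃₂; _×_; _,_; proj₁; proj₂)
open import Data.Sum using (_⊎_; inj₁; inj₂)
open import Data.Empty using (⊥; ⊥-elim)
open import Function.Bundles using (mk⇔)
open import Relation.Nullary using (¬_; Dec; yes; no)
open import Relation.Binary.Definitions using (tri<; tri≈; tri>)
open import Relation.Binary.PropositionalEquality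
open import Relation.Binary.PropositionalEquality.Properties using (setoid)
open import Data.List using (List; []; _∷_; _++_; length; map; filter; upTo; take; drop; deduplicate)
open import Data.List.Properties
  using ( length-map; length-++; length-upTo; map-++; map-∘; map-id; map-cong; map-cong-local
        ; take++drop≡id; ≡-dec; filter-++; filter-all; filter-none; filter-accept; filter-reject; filter-notAll)
open import Data.List.Membership.Propositional using (_∈_)
open import Data.List.Membership.Propositional.Properties
  using ( ∈-map⁺; ∈-map⁻; ∈-++⁺ˡ; ∈-++⁺ʳ; ∈-++⁻; ∈-∃++; ∈-upTo⁺; ∈-upTo⁻
        ; ∈-filter⁺; ∈-filter⁻; ∈-deduplicate⁺; ∈-deduplicate⁻)
open import Data.List.Membership.Propositional.Properties.WithK using (unique∧set⇒bag)
open import Data.List.Membership.DecPropositional _≟_ using (_∈?_)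
open import Data.List.Membership.DecPropositional (≡-dec _≟_) using () renaming (_∈?_ to _∈ₗ?_)
open import Data.List.Relation.Unary.Any as Any using (here; there)
open import Data.List.Relation.Unary.All as All using (All)
open import Data.List.Relation.Unary.AllPairs using ([]; _∷_)
open import Data.List.Relation.Unary.Unique.Propositional using (Unique)
import Data.List.Relation.Unary.Unique.Propositional.Properties as Unique
open import Data.List.Relation.Unary.Unique.DecPropositional.Properties (≡-dec _≟_) using (deduplicate-!)
open import Data.List.Relation.Binary.Equality.Propositional using (≋⇒≡)
open import Data.List.Relation.Binary.BagAndSetEquality using (∼bag⇒↭)
open import Data.List.Relation.Binary.Permutation.Propositional
  using (_↭_; ↭-sym; ↭-refl; ↭-trans; ↭-reflexive; ↭⇒↭ₛ)
open import Data.List.Relation.Binary.Permutation.Propositional.Properties using (∈-resp-↭)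
import Data.List.Relation.Binary.Permutation.Propositional.Properties as Perm
open import Data.List.Relation.Binary.Permutation.Setoid.Properties (setoid ℕ) using (Unique-resp-↭)
open import Data.List.Relation.Binary.Permutation.Setoid.Properties (setoid ℤ) using (foldr-commMonoid)
open import Data.List.Relation.Binary.Sublist.Propositional {A = ℕ}
  using (_⊆_; []; _∷_; _∷ʳ_; ⊆-refl; ⊆-trans; lookup)
import Data.List.Relation.Binary.Sublist.Propositional.Properties as Sublist

-- below l v counts the entries of l smaller than v, and rank l v = 1 + below l v,
-- so that std s ≡ map (rank s) s holds by definition.
below : List ℕ → ℕ → ℕ
below l v = length (filter (_<? v) l)

rank : List ℕ → ℕ → ℕ
rank l v = suc (below l v)

below-∷< : ∀ {x} l {v} → x < v → below (x ∷ l) v ≡ suc (below l v)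
below-∷< l {v} x<v = cong length (filter-accept (_<? v) x<v)

below-∷≮ : ∀ {x} l {v} → ¬ x < v → below (x ∷ l) v ≡ below l v
below-∷≮ l {v} x≮v = cong length (filter-reject (_<? v) x≮v)

below-++ : ∀ a b v → below (a ++ b) v ≡ below a v + below b v
below-++ a b v = trans (cong length (filter-++ (_<? v) a b)) (length-++ (filter (_<? v) a))

below-all : ∀ l {v} → (∀ {u} → u ∈ l → u < v) → below l v ≡ length l
below-all l {v} h = cong length (filter-all (_<? v) (All.tabulate h))

below-none : ∀ l {v} → (∀ {u} → u ∈ l → ¬ u < v) → below l v ≡ 0
below-none l {v} h = cong length (filter-none (_<? v) (All.tabulate h))

below-<-length : ∀ l {v} → v ∈ l → below l v < length l
below-<-length l {v} v∈l = filter-notAll (_<? v) l (Any.map (λ { refl → n≮n v }) v∈l)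

below-mono : ∀ l {u v} → u ≤ v → below l u ≤ below l v
below-mono [] u≤v = z≤n
below-mono (x ∷ l) {u} {v} u≤v with x <? u | x <? v
... | yes x<u | yes x<v rewrite below-∷< l x<u | below-∷< l x<v = s≤s (below-mono l u≤v)
... | yes x<u | no x≮v = ⊥-elim (x≮v (<-≤-trans x<u u≤v))
... | no x≮u | yes x<v rewrite below-∷≮ l x≮u | below-∷< l x<v = m≤n⇒m≤1+n (below-mono l u≤v)
... | no x≮u | no x≮v rewrite below-∷≮ l x≮u | below-∷≮ l x≮v = below-mono l u≤v

below-strict : ∀ l {u v} → u ∈ l → u < v → below l u < below l v
below-strict (x ∷ l) {u} {v} (here refl) u<v
  rewrite below-∷≮ l {u} (n≮n u) | below-∷< l u<v = s≤s (below-mono l (<⇒≤ u<v))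
below-strict (x ∷ l) {u} {v} (there u∈l) u<v with x <? u | x <? v
... | yes x<u | yes x<v rewrite below-∷< l x<u | below-∷< l x<v = s≤s (below-strict l u∈l u<v)
... | yes x<u | no x≮v = ⊥-elim (x≮v (<-trans x<u u<v))
... | no x≮u | yes x<v rewrite below-∷≮ l x≮u | below-∷< l x<v = m≤n⇒m≤1+n (below-strict l u∈l u<v)
... | no x≮u | no x≮v rewrite below-∷≮ l x≮u | below-∷≮ l x≮v = below-strict l u∈l u<v

below-map : ∀ (g : ℕ → ℕ) l {v w} →
  (∀ {u} → u ∈ l → (u < v → g u < w) × (g u < w → u < v)) →
  below (map g l) w ≡ below l v
below-map g [] h = refl
below-map g (x ∷ l) {v} {w} h with g x <? w | x <? v
... | yes gx<w | yes x<v rewrite below-∷< (map g l) gx<w | below-∷< l x<v =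
  cong suc (below-map g l (λ u∈l → h (there u∈l)))
... | yes gx<w | no x≮v = ⊥-elim (x≮v (proj₂ (h (here refl)) gx<w))
... | no gx≮w | yes x<v = ⊥-elim (gx≮w (proj₁ (h (here refl)) x<v))
... | no gx≮w | no x≮v rewrite below-∷≮ (map g l) gx≮w | below-∷≮ l x≮v =
  below-map g l (λ u∈l → h (there u∈l))

below-threshold : ∀ l {v w} → (∀ {u} → u ∈ l → (u < v → u < w) × (u < w → u < v)) →
  below l v ≡ below l w
below-threshold l {v} {w} h = trans (sym (below-map (λ u → u) l h)) (cong (λ k → below k w) (map-id l))

OrderIso : (ℕ → ℕ) → List ℕ → Set
OrderIso f l = ∀ {u v} → u ∈ l → v ∈ l → (u < v → f u < f v) × (f u < f v → u < v)

OrderIso-⊆ : ∀ {f l l′} → OrderIso f l → (∀ {x} → x ∈ l′ → x ∈ l) → OrderIso f l′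
OrderIso-⊆ iso sub u∈ v∈ = iso (sub u∈) (sub v∈)

std-map : ∀ f l → OrderIso f l → std (map f l) ≡ std l
std-map f l iso = begin
  map (rank (map f l)) (map f l)     ≡⟨ sym (map-∘ l) ⟩
  map (λ x → rank (map f l) (f x)) l ≡⟨ map-cong-local (All.tabulate (λ x∈l →
                                          cong suc (below-map f l (λ u∈l → iso u∈l x∈l)))) ⟩
  map (rank l) l                     ∎
  where open ≡-Reasoning

rank-orderIso : ∀ l → OrderIso (rank l) l
rank-orderIso l {u} {v} u∈l v∈l = (λ u<v → s≤s (below-strict l u∈l u<v)) , reflect
  where
  reflect : rank l u < rank l v → u < v
  reflect r with <-cmp u v
  ... | tri< u<v _ _ = u<v
  ... | tri≈ _ refl _ = ⊥-elim (n≮n _ r)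
  ... | tri> _ _ v<u = ⊥-elim (<-asym r (s≤s (below-strict l v∈l v<u)))

std-idem : ∀ s → std (std s) ≡ std s
std-idem s = std-map (rank s) s (rank-orderIso s)

length-std : ∀ s → length (std s) ≡ length s
length-std s = length-map _ s

⊆⇒∈subs : ∀ {s} l → s ⊆ l → s ∈ subs l
⊆⇒∈subs [] [] = here refl
⊆⇒∈subs (x ∷ l) (_ ∷ʳ p) = ∈-++⁺ʳ (map (x ∷_) (subs l)) (⊆⇒∈subs l p)
⊆⇒∈subs (x ∷ l) (refl ∷ p) = ∈-++⁺ˡ (∈-map⁺ (x ∷_) (⊆⇒∈subs l p))

∈subs⇒⊆ : ∀ l {s} → s ∈ subs l → s ⊆ l
∈subs⇒⊆ [] (here refl) = []
∈subs⇒⊆ (x ∷ l) s∈ with ∈-++⁻ (map (x ∷_) (subs l)) s∈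
... | inj₁ s∈map with ∈-map⁻ (x ∷_) s∈map
...   | s′ , s′∈ , refl = refl ∷ ∈subs⇒⊆ l s′∈
∈subs⇒⊆ (x ∷ l) s∈ | inj₂ s∈rest = x ∷ʳ ∈subs⇒⊆ l s∈rest

⊆-map⁻ : ∀ (f : ℕ → ℕ) t {s} → s ⊆ map f t → ∃ λ s′ → s′ ⊆ t × s ≡ map f s′
⊆-map⁻ f [] [] = [] , [] , refl
⊆-map⁻ f (x ∷ t) (_ ∷ʳ p) with ⊆-map⁻ f t p
... | s′ , q , e = s′ , x ∷ʳ q , e
⊆-map⁻ f (x ∷ t) (refl ∷ p) with ⊆-map⁻ f t p
... | s′ , q , e = x ∷ s′ , refl ∷ q , cong (f x ∷_) e

⊆-++⁻ : ∀ a {b s} → s ⊆ a ++ b → ∃₂ λ s₁ s₂ → s₁ ⊆ a × s₂ ⊆ b × s ≡ s₁ ++ s₂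
⊆-++⁻ [] p = [] , _ , [] , p , refl
⊆-++⁻ (x ∷ a) (_ ∷ʳ p) with ⊆-++⁻ a p
... | s₁ , s₂ , p₁ , p₂ , e = s₁ , s₂ , x ∷ʳ p₁ , p₂ , e
⊆-++⁻ (x ∷ a) (refl ∷ p) with ⊆-++⁻ a p
... | s₁ , s₂ , p₁ , p₂ , e = x ∷ s₁ , s₂ , refl ∷ p₁ , p₂ , cong (x ∷_) e

Unique-⊆ : ∀ {s l} → s ⊆ l → Unique l → Unique s
Unique-⊆ [] u = u
Unique-⊆ (_ ∷ʳ p) (_ ∷ u) = Unique-⊆ p u
Unique-⊆ (refl ∷ p) (x∉ ∷ u) = Sublist.All-resp-⊆ p x∉ ∷ Unique-⊆ p u

⊆-full : ∀ {s l} → s ⊆ l → length s ≡ length l → s ≡ l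
⊆-full p len = ≋⇒≡ (Sublist.to-≋ len p)

pattern⁺ : ∀ {s π} → s ⊆ π → std s ≼ π
pattern⁺ {π = π} p = ∈-map⁺ std (⊆⇒∈subs π p)

pattern⁻ : ∀ {τ} π → τ ≼ π → ∃ λ s → s ⊆ π × τ ≡ std s
pattern⁻ π τ≼π with ∈-map⁻ std τ≼π
... | s , s∈ , e = s , ∈subs⇒⊆ π s∈ , e

⊆-std⁻ : ∀ {s w} → s ⊆ std w → ∃ λ s′ → s′ ⊆ w × std s ≡ std s′
⊆-std⁻ {s} {w} p with ⊆-map⁻ (rank w) w p
... | s′ , q , refl = s′ , q , std-map (rank w) s′ (OrderIso-⊆ (rank-orderIso w) (lookup q))

std-⊆ : ∀ {s L} → s ⊆ L → std s ≼ std L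
std-⊆ {s} {L} p = subst (_≼ std L) (std-map (rank L) s (OrderIso-⊆ (rank-orderIso L) (lookup p)))
  (pattern⁺ (Sublist.map⁺ (rank L) p))

≼-trans : ∀ {σ τ π} → σ ≼ τ → τ ≼ π → σ ≼ π
≼-trans {σ} {τ} {π} σ≼τ τ≼π with pattern⁻ π τ≼π
... | t , t⊆π , refl with pattern⁻ τ σ≼τ
... | s , s⊆τ , refl with ⊆-std⁻ s⊆τ
... | s′ , s′⊆t , e = subst (_≼ π) (sym e) (pattern⁺ (⊆-trans s′⊆t t⊆π))

≼-strict : ∀ {τ ρ} → std ρ ≡ ρ → τ ≼ ρ → τ ≢ ρ → length τ < length ρ
≼-strict {τ} {ρ} std-ρ τ≼ρ τ≢ρ with pattern⁻ ρ τ≼ρ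
... | s , s⊆ρ , refl with m≤n⇒m<n∨m≡n (Sublist.length-mono-≤ s⊆ρ)
... | inj₁ shorter = subst (_< length ρ) (sym (length-std s)) shorter
... | inj₂ same = ⊥-elim (τ≢ρ (trans (cong std (⊆-full s⊆ρ same)) std-ρ))

same-elements-↭ : ∀ {A : Set} {xs ys : List A} → Unique xs → Unique ys →
  (∀ {z} → z ∈ xs → z ∈ ys) → (∀ {z} → z ∈ ys → z ∈ xs) → xs ↭ ys
same-elements-↭ uxs uys to from = ∼bag⇒↭ (unique∧set⇒bag uxs uys (mk⇔ to from))

map-unique : ∀ (f : ℕ → ℕ) l → (∀ {x y} → x ∈ l → y ∈ l → f x ≡ f y → x ≡ y) →
  Unique l → Unique (map f l)
map-unique f [] inj u = []
map-unique f (x ∷ l) inj (x∉ ∷ u) =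
  All.tabulate fx∉ ∷ map-unique f l (λ x∈ y∈ → inj (there x∈) (there y∈)) u
  where
  fx∉ : ∀ {z} → z ∈ map f l → f x ≢ z
  fx∉ z∈ with ∈-map⁻ f z∈
  ... | y , y∈l , refl = λ fx≡fy → All.lookup x∉ y∈l (inj (here refl) (there y∈l) fx≡fy)

∈-delete : ∀ (U₁ : List ℕ) {U₂ x y} → y ∈ U₁ ++ x ∷ U₂ → y ≢ x → y ∈ U₁ ++ U₂
∈-delete [] (here y≡x) y≢x = ⊥-elim (y≢x y≡x)
∈-delete [] (there y∈) y≢x = y∈
∈-delete (z ∷ U₁) (here y≡z) y≢x = here y≡z
∈-delete (z ∷ U₁) (there y∈) y≢x = there (∈-delete U₁ y∈ y≢x)

unique-length-≤ : ∀ l U → Unique l → (∀ {x} → x ∈ l → x ∈ U) → length l ≤ length U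
unique-length-≤ [] U u sub = z≤n
unique-length-≤ (x ∷ l) U (x∉ ∷ u) sub with ∈-∃++ (sub (here refl))
... | U₁ , U₂ , refl = begin
  suc (length l)              ≤⟨ s≤s (unique-length-≤ l (U₁ ++ U₂) u sub′) ⟩
  suc (length (U₁ ++ U₂))     ≡⟨ cong suc (length-++ U₁) ⟩
  suc (length U₁ + length U₂) ≡⟨ sym (+-suc (length U₁) (length U₂)) ⟩
  length U₁ + length (x ∷ U₂) ≡⟨ sym (length-++ U₁) ⟩
  length (U₁ ++ x ∷ U₂)       ∎
  where
  open ≤-Reasoning
  sub′ : ∀ {y} → y ∈ l → y ∈ U₁ ++ U₂
  sub′ y∈l = ∈-delete U₁ (sub (there y∈l)) (λ y≡x → All.lookup x∉ y∈l (sym y≡x))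

unique-covers : ∀ l U → Unique l → (∀ {x} → x ∈ l → x ∈ U) → length U ≤ length l →
  ∀ {y} → y ∈ U → y ∈ l
unique-covers l U u sub long {y} y∈U with y ∈? l
... | yes y∈l = y∈l
... | no y∉l with ∈-∃++ y∈U
... | U₁ , U₂ , refl = ⊥-elim (<⇒≱ too-long long)
  where
  too-long : length l < length (U₁ ++ y ∷ U₂)
  too-long = begin-strict
    length l                    ≤⟨ unique-length-≤ l (U₁ ++ U₂) u
                                     (λ x∈l → ∈-delete U₁ (sub x∈l) (λ { refl → y∉l x∈l })) ⟩
    length (U₁ ++ U₂)           ≡⟨ length-++ U₁ ⟩
    length U₁ + length U₂       <⟨ +-monoʳ-< (length U₁) (n<1+n (length U₂)) ⟩
    length U₁ + length (y ∷ U₂) ≡⟨ sym (length-++ U₁) ⟩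
    length (U₁ ++ y ∷ U₂)       ∎
    where open ≤-Reasoning

-- block a n lists the n consecutive values a, …, a + n - 1; note that
-- IsPerm π is, by definition, π ↭ block 1 (length π).
block : ℕ → ℕ → List ℕ
block a n = map (a +_) (upTo n)

block⁺ : ∀ {a n x} → a ≤ x → x < a + n → x ∈ block a n
block⁺ {a} {n} {x} a≤x x<a+n = subst (_∈ block a n) (m+[n∸m]≡n a≤x)
  (∈-map⁺ (a +_) (∈-upTo⁺ (+-cancelˡ-< a _ _ (subst (_< a + n) (sym (m+[n∸m]≡n a≤x)) x<a+n))))

block⁻ : ∀ {a n x} → x ∈ block a n → a ≤ x × x < a + n
block⁻ {a} x∈ with ∈-map⁻ (a +_) x∈
... | j , j∈ , refl = m≤m+n a j , +-monoʳ-< a (∈-upTo⁻ j∈)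

length-block : ∀ a n → length (block a n) ≡ n
length-block a n = trans (length-map _ (upTo n)) (length-upTo n)

block-unique : ∀ a n → Unique (block a n)
block-unique a n = Unique.map⁺ (+-cancelˡ-≡ a _ _) (Unique.upTo⁺ n)

↭-block : ∀ l a n → Unique l → (∀ {x} → x ∈ l → a ≤ x × x < a + n) → length l ≡ n →
  l ↭ block a n
↭-block l a n u range len = same-elements-↭ u (block-unique a n) into
  (unique-covers l (block a n) u into (≤-reflexive (trans (length-block a n) (sym len))))
  where
  into : ∀ {x} → x ∈ l → x ∈ block a n
  into x∈ = block⁺ (proj₁ (range x∈)) (proj₂ (range x∈))

perm-unique : ∀ {π} → IsPerm π → Unique π
perm-unique {π} p = Unique-resp-↭ (↭⇒↭ₛ (↭-sym p)) (block-unique 1 (length π))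

rank-injective : ∀ l {x y} → x ∈ l → y ∈ l → rank l x ≡ rank l y → x ≡ y
rank-injective l {x} {y} x∈ y∈ e with <-cmp x y
... | tri< x<y _ _ = ⊥-elim (<-irrefl e (proj₁ (rank-orderIso l x∈ y∈) x<y))
... | tri≈ _ x≡y _ = x≡y
... | tri> _ _ y<x = ⊥-elim (<-irrefl (sym e) (proj₁ (rank-orderIso l y∈ x∈) y<x))

std-unique : ∀ s → Unique s → Unique (std s)
std-unique s = map-unique (rank s) s (rank-injective s)

std-perm : ∀ s → Unique s → IsPerm (std s)
std-perm s u = ↭-block (std s) 1 (length (std s)) (std-unique s u) range refl
  where
  range : ∀ {x} → x ∈ std s → 1 ≤ x × x < 1 + length (std s)
  range x∈ with ∈-map⁻ (rank s) x∈
  ... | v , v∈s , refl = s≤s z≤n , s≤s (subst (below s v <_) (sym (length-std s)) (below-<-length s v∈s))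

pattern-perm : ∀ {τ π} → Unique π → τ ≼ π → IsPerm τ
pattern-perm {π = π} u τ≼π with pattern⁻ π τ≼π
... | s , s⊆π , refl = std-perm s (Unique-⊆ s⊆π u)

drop-length-++ : ∀ (l r : List ℕ) → drop (length l) (l ++ r) ≡ r
drop-length-++ [] r = refl
drop-length-++ (x ∷ l) r = drop-length-++ l r

take-length-++ : ∀ (l r : List ℕ) → take (length l) (l ++ r) ≡ l
take-length-++ [] r = refl
take-length-++ (x ∷ l) r = cong (x ∷_) (take-length-++ l r)

interval-copy : ∀ P S Q → 1 ≤ length S → Consecutive S → HasIntervalCopy (P ++ S ++ Q) (std S)
interval-copy P S Q nonempty consecutive =
  subst (1 ≤_) (sym (length-std S)) nonempty , length P ,
  subst (λ z → length z ≡ length (std S) × Consecutive z × std z ≡ std S) (sym factor)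
    (sym (length-std S) , consecutive , refl)
  where
  factor : take (length (std S)) (drop (length P) (P ++ S ++ Q)) ≡ S
  factor rewrite drop-length-++ P (S ++ Q) | length-std S = take-length-++ S Q

interval-split : ∀ {π φ} → HasIntervalCopy π φ → ∃₂ λ A w → ∃₂ λ C lo →
  π ≡ A ++ w ++ C × w ↭ block lo (length w) × std w ≡ φ
interval-split {π} {φ} (_ , i , _ , (lo , values) , shape) =
  take i π , w , drop (length φ) (drop i π) , lo ,
  sym (trans (cong (take i π ++_) (take++drop≡id (length φ) (drop i π))) (take++drop≡id i π)) ,
  values , shape
  where
  w : List ℕ
  w = take (length φ) (drop i π)

std-shift : ∀ K l → std (map (K +_) l) ≡ std l
std-shift K l = std-map (K +_) l (λ _ _ → +-monoʳ-< K , +-cancelˡ-< K _ _)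

shifted-std-consecutive : ∀ K s → Unique s → Consecutive (map (K +_) (std s))
shifted-std-consecutive K s u =
  suc K , subst (λ n → map (K +_) (std s) ↭ block (suc K) n) (sym (length-map (K +_) (std s)))
    (↭-trans (Perm.map⁺ (K +_) (std-perm s u)) (↭-reflexive shift))
  where
  shift : map (K +_) (block 1 (length (std s))) ≡ block (suc K) (length (std s))
  shift = trans (sym (map-∘ (upTo (length (std s))))) (map-cong (+-suc K) (upTo (length (std s))))

std-++₃ : ∀ a x c → let r = rank (a ++ x ++ c) in std (a ++ x ++ c) ≡ map r a ++ map r x ++ map r c
std-++₃ a x c = trans (map-++ _ a (x ++ c)) (cong (map (rank (a ++ x ++ c)) a ++_) (map-++ _ x c))

InWindow : ℕ → ℕ → ℕ → Set
InWindow lo k v = lo ≤ v × v < lo + k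

module ValueWindow (lo k : ℕ) where

  Inside : List ℕ → Set
  Inside l = ∀ {v} → v ∈ l → InWindow lo k v

  Outside : List ℕ → Set
  Outside l = ∀ {v} → v ∈ l → ¬ InWindow lo k v

  outside-vs-inside : ∀ {u v} → ¬ InWindow lo k u → InWindow lo k v → (u < v → u < lo) × (u < lo → u < v)
  outside-vs-inside {u} {v} u-out (lo≤v , v<) = to , λ u<lo → <-≤-trans u<lo lo≤v
    where
    to : u < v → u < lo
    to u<v with u <? lo
    ... | yes u<lo = u<lo
    ... | no u≮lo = ⊥-elim (u-out (≮⇒≥ u≮lo , <-trans u<v v<))

  below-inside : ∀ x y → Inside x → Inside y → length x ≡ length y →
    ∀ {v} → ¬ InWindow lo k v → below x v ≡ below y v
  below-inside x y x-in y-in len {v} v-out with v <? lo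
  ... | yes v<lo = trans (below-none x (λ u∈ u<v → <-irrefl refl (<-≤-trans (<-trans u<v v<lo) (proj₁ (x-in u∈)))))
                        (sym (below-none y (λ u∈ u<v → <-irrefl refl (<-≤-trans (<-trans u<v v<lo) (proj₁ (y-in u∈))))))
  ... | no v≮lo = trans (below-all x (λ u∈ → <-≤-trans (proj₂ (x-in u∈)) above))
                  (trans len (sym (below-all y (λ u∈ → <-≤-trans (proj₂ (y-in u∈)) above))))
    where
    above : lo + k ≤ v
    above with lo + k ≤? v
    ... | yes le = le
    ... | no nle = ⊥-elim (v-out (≮⇒≥ v≮lo , ≰⇒> nle))

  below-++₃ : ∀ a x c v → below (a ++ x ++ c) v ≡ below a v + (below x v + below c v)
  below-++₃ a x c v = trans (below-++ a (x ++ c) v) (cong (below a v +_) (below-++ x c v))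

  rank-inside : ∀ a x c → Inside x → Outside a → Outside c →
    ∀ {v} → v ∈ x → rank (a ++ x ++ c) v ≡ (below a lo + below c lo) + rank x v
  rank-inside a x c x-in a-out c-out {v} v∈x = begin
    suc (below (a ++ x ++ c) v)               ≡⟨ cong suc (below-++₃ a x c v) ⟩
    suc (below a v + (below x v + below c v)) ≡⟨ cong₂ (λ p q → suc (p + (below x v + q)))
                                                   (below-threshold a (λ u∈ → outside-vs-inside (a-out u∈) (x-in v∈x)))
                                                   (below-threshold c (λ u∈ → outside-vs-inside (c-out u∈) (x-in v∈x))) ⟩
    suc (A + (X + C))                         ≡⟨ regroup A X C ⟩
    (A + C) + suc X                           ∎
    where
    open ≡-Reasoning
    A : ℕ
    A = below a lo
    C : ℕ
    C = below c lo
    X : ℕ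
    X = below x v
    regroup : ∀ p q r → suc (p + (q + r)) ≡ (p + r) + suc q
    regroup = solve-∀

  rank-outside : ∀ a x y c → Inside x → Inside y → length x ≡ length y →
    ∀ {v} → ¬ InWindow lo k v → rank (a ++ x ++ c) v ≡ rank (a ++ y ++ c) v
  rank-outside a x y c x-in y-in len {v} v-out = cong suc (begin
    below (a ++ x ++ c) v               ≡⟨ below-++₃ a x c v ⟩
    below a v + (below x v + below c v) ≡⟨ cong (λ z → below a v + (z + below c v)) (below-inside x y x-in y-in len v-out) ⟩
    below a v + (below y v + below c v) ≡⟨ below-++₃ a y c v ⟨
    below (a ++ y ++ c) v               ∎)
    where open ≡-Reasoning

  std-inside : ∀ a x c → Inside x → Outside a → Outside c →
    map (rank (a ++ x ++ c)) x ≡ map ((below a lo + below c lo) +_) (std x)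
  std-inside a x c x-in a-out c-out =
    trans (map-cong-local (All.tabulate (rank-inside a x c x-in a-out c-out))) (map-∘ x)

  std-replace : ∀ a x y c → Inside x → Inside y → Outside a → Outside c → std x ≡ std y →
    std (a ++ x ++ c) ≡ std (a ++ y ++ c)
  std-replace a x y c x-in y-in a-out c-out same = begin
    std (a ++ x ++ c)                          ≡⟨ std-++₃ a x c ⟩
    map rx a ++ map rx x ++ map rx c           ≡⟨ cong₂ (λ p q → p ++ q ++ map rx c)
                                                    (map-cong-local (All.tabulate (λ v∈ → outside (a-out v∈))))
                                                    (std-inside a x c x-in a-out c-out) ⟩
    map ry a ++ map (K +_) (std x) ++ map rx c ≡⟨ cong₂ (λ p q → map ry a ++ map (K +_) p ++ q) same
                                                    (map-cong-local (All.tabulate (λ v∈ → outside (c-out v∈)))) ⟩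
    map ry a ++ map (K +_) (std y) ++ map ry c ≡⟨ cong (λ p → map ry a ++ p ++ map ry c) (std-inside a y c y-in a-out c-out) ⟨
    map ry a ++ map ry y ++ map ry c           ≡⟨ std-++₃ a y c ⟨
    std (a ++ y ++ c)                          ∎
    where
    open ≡-Reasoning
    rx : ℕ → ℕ
    rx = rank (a ++ x ++ c)
    ry : ℕ → ℕ
    ry = rank (a ++ y ++ c)
    K : ℕ
    K = below a lo + below c lo
    outside : ∀ {v} → ¬ InWindow lo k v → rx v ≡ ry v
    outside = rank-outside a x y c x-in y-in
                (trans (sym (length-std x)) (trans (cong length same) (length-std y)))

  inside-copy : ∀ a x c → Inside x → Outside a → Outside c → Unique x → 1 ≤ length x →
    HasIntervalCopy (std (a ++ x ++ c)) (std x)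
  inside-copy a x c x-in a-out c-out ux nonempty =
    subst₂ HasIntervalCopy (sym layout) (trans (std-shift K (std x)) (std-idem x))
      (interval-copy (map r a) (map (K +_) (std x)) (map r c) nonempty′ (shifted-std-consecutive K x ux))
    where
    K : ℕ
    K = below a lo + below c lo
    r : ℕ → ℕ
    r = rank (a ++ x ++ c)
    layout : std (a ++ x ++ c) ≡ map r a ++ map (K +_) (std x) ++ map r c
    layout = trans (std-++₃ a x c) (cong (λ z → map r a ++ z ++ map r c) (std-inside a x c x-in a-out c-out))
    nonempty′ : 1 ≤ length (map (K +_) (std x))
    nonempty′ rewrite length-map (K +_) (std x) | length-std x = nonempty

-- The list summed over in the recursion for μ σ π: the interval [σ, π), without repetitions.
halfOpen : List ℕ → List ℕ → List (List ℕ)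
halfOpen σ π = deduplicate (≡-dec _≟_) (filter (λ τ → σ ∈ₗ? patterns τ) (properPatterns π))

properPatterns⁻ : ∀ {τ} π → τ ∈ properPatterns π → τ ≼ π × length τ < length π
properPatterns⁻ {τ} π τ∈ with ∈-map⁻ std τ∈
... | s , s∈ , refl with ∈-filter⁻ (λ s → length s <? length π) {xs = subs π} s∈
... | s∈subs , shorter = ∈-map⁺ std s∈subs , subst (_< length π) (sym (length-std s)) shorter

properPatterns⁺ : ∀ {τ} π → τ ≼ π → length τ < length π → τ ∈ properPatterns π
properPatterns⁺ {τ} π τ≼π shorter with ∈-map⁻ std τ≼π
... | s , s∈ , refl = ∈-map⁺ std (∈-filter⁺ (λ s → length s <? length π) s∈ (subst (_< length π) (length-std s) shorter))

halfOpen⁻ : ∀ σ π {τ} → τ ∈ halfOpen σ π → σ ≼ τ × τ ≼ π × length τ < length π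
halfOpen⁻ σ π τ∈ with ∈-filter⁻ (λ τ → σ ∈ₗ? patterns τ) {xs = properPatterns π} (∈-deduplicate⁻ (≡-dec _≟_) _ τ∈)
... | τ∈proper , σ≼τ = σ≼τ , properPatterns⁻ π τ∈proper

halfOpen⁺ : ∀ σ π {τ} → σ ≼ τ → τ ≼ π → length τ < length π → τ ∈ halfOpen σ π
halfOpen⁺ σ π σ≼τ τ≼π shorter =
  ∈-deduplicate⁺ (≡-dec _≟_) (∈-filter⁺ (λ τ → σ ∈ₗ? patterns τ) (properPatterns⁺ π τ≼π shorter) σ≼τ)

μF-fuel : ∀ k j σ π → length π < k → length π < j → μF k σ π ≡ μF j σ π
μF-fuel (suc k) (suc j) σ π π<k π<j with ≡-dec _≟_ σ π
... | yes _ = refl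
... | no _ with σ ∈ₗ? patterns π
...   | no _ = refl
...   | yes _ = cong (λ z → - sumℤ z) (map-cong-local (All.tabulate λ {τ} τ∈ →
          let τ<π = proj₂ (proj₂ (halfOpen⁻ σ π τ∈)) in
          μF-fuel k j σ τ (≤-trans τ<π (≤-pred π<k)) (≤-trans τ<π (≤-pred π<j))))

μ-unfold : ∀ σ π → σ ≢ π → σ ≼ π → μ σ π ≡ - sumℤ (map (μ σ) (halfOpen σ π))
μ-unfold σ π σ≢π σ≼π with ≡-dec _≟_ σ π
... | yes σ≡π = ⊥-elim (σ≢π σ≡π)
... | no _ with σ ∈ₗ? patterns π
...   | no σ⋠π = ⊥-elim (σ⋠π σ≼π)
...   | yes _ = cong (λ z → - sumℤ z) (map-cong-local (All.tabulate λ {τ} τ∈ →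
          μF-fuel (length π) (suc (length τ)) σ τ (proj₂ (proj₂ (halfOpen⁻ σ π τ∈))) (n<1+n _)))

μ-outside : ∀ σ π → σ ≢ π → ¬ σ ≼ π → μ σ π ≡ 0ℤ
μ-outside σ π σ≢π σ⋠π with ≡-dec _≟_ σ π
... | yes σ≡π = ⊥-elim (σ≢π σ≡π)
... | no _ with σ ∈ₗ? patterns π
...   | no _ = refl
...   | yes σ≼π = ⊥-elim (σ⋠π σ≼π)

sumℤ-↭ : ∀ {xs ys : List ℤ} → xs ↭ ys → sumℤ xs ≡ sumℤ ys
sumℤ-↭ p = foldr-commMonoid ℤP.+-0-isCommutativeMonoid (↭⇒↭ₛ p)

sumℤ-drop-zeros : ∀ {A : Set} {P : A → Set} (P? : ∀ τ → Dec (P τ)) (g : A → ℤ) (xs : List A) →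
  (∀ {τ} → τ ∈ xs → ¬ P τ → g τ ≡ 0ℤ) → sumℤ (map g xs) ≡ sumℤ (map g (filter P? xs))
sumℤ-drop-zeros P? g [] vanish = refl
sumℤ-drop-zeros P? g (x ∷ xs) vanish with P? x
... | yes _ = cong (λ z → g x ℤ.+ z) (sumℤ-drop-zeros P? g xs (λ τ∈ → vanish (there τ∈)))
... | no ¬Px = begin
  g x ℤ.+ sumℤ (map g xs) ≡⟨ cong (λ z → z ℤ.+ sumℤ (map g xs)) (vanish (here refl) ¬Px) ⟩
  0ℤ ℤ.+ sumℤ (map g xs)  ≡⟨ ℤP.+-identityˡ _ ⟩
  sumℤ (map g xs)         ≡⟨ sumℤ-drop-zeros P? g xs (λ τ∈ → vanish (there τ∈)) ⟩
  sumℤ (map g (filter P? xs)) ∎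
  where open ≡-Reasoning

closed-interval-sum : ∀ σ ρ → σ ≢ ρ → σ ≼ ρ → sumℤ (map (μ σ) (ρ ∷ halfOpen σ ρ)) ≡ 0ℤ
closed-interval-sum σ ρ σ≢ρ σ≼ρ = begin
  μ σ ρ ℤ.+ S   ≡⟨ cong (λ z → z ℤ.+ S) (μ-unfold σ ρ σ≢ρ σ≼ρ) ⟩
  - S ℤ.+ S     ≡⟨ ℤP.+-inverseˡ S ⟩
  0ℤ            ∎
  where
  open ≡-Reasoning
  S : ℤ
  S = sumℤ (map (μ σ) (halfOpen σ ρ))

halfOpen-cut : ∀ σ π ρ → std ρ ≡ ρ → ρ ≼ π → length ρ < length π → σ ≼ ρ →
  filter (_∈ₗ? patterns ρ) (halfOpen σ π) ↭ ρ ∷ halfOpen σ ρ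
halfOpen-cut σ π ρ std-ρ ρ≼π ρ<π σ≼ρ = same-elements-↭
  (Unique.filter⁺ (_∈ₗ? patterns ρ) (deduplicate-! (filter (λ τ → σ ∈ₗ? patterns τ) (properPatterns π)))) (distinct-top ∷ deduplicate-! _) to from
  where
  distinct-top : All (ρ ≢_) (halfOpen σ ρ)
  distinct-top = All.tabulate (λ τ∈ ρ≡τ → <-irrefl (cong length (sym ρ≡τ)) (proj₂ (proj₂ (halfOpen⁻ σ ρ τ∈))))
  to : ∀ {τ} → τ ∈ filter (_∈ₗ? patterns ρ) (halfOpen σ π) → τ ∈ ρ ∷ halfOpen σ ρ
  to {τ} τ∈ with ∈-filter⁻ (_∈ₗ? patterns ρ) {xs = halfOpen σ π} τ∈
  ... | τ∈π , τ≼ρ with ≡-dec _≟_ τ ρ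
  ...   | yes τ≡ρ = here τ≡ρ
  ...   | no τ≢ρ = there (halfOpen⁺ σ ρ (proj₁ (halfOpen⁻ σ π τ∈π)) τ≼ρ (≼-strict std-ρ τ≼ρ τ≢ρ))
  from : ∀ {τ} → τ ∈ ρ ∷ halfOpen σ ρ → τ ∈ filter (_∈ₗ? patterns ρ) (halfOpen σ π)
  from (here refl) = ∈-filter⁺ (_∈ₗ? patterns ρ) (halfOpen⁺ σ π σ≼ρ ρ≼π ρ<π)
    (subst₂ _≼_ std-ρ std-ρ (std-⊆ {ρ} ⊆-refl))
  from {τ} (there τ∈) with halfOpen⁻ σ ρ τ∈
  ... | σ≼τ , τ≼ρ , τ<ρ = ∈-filter⁺ (_∈ₗ? patterns ρ) (halfOpen⁺ σ π σ≼τ (≼-trans {τ} {ρ} {π} τ≼ρ ρ≼π) (<-trans τ<ρ ρ<π)) τ≼ρ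

-- If every
-- τ ∈ [σ, π) not contained in ρ is a σ-zero, then so is π: the remaining terms of
-- the recursion form [σ, ρ] (or nothing, when σ ≰ ρ), whose Möbius sum vanishes.
zero-by-cut : ∀ σ π ρ → std ρ ≡ ρ → ρ ≼ π → length ρ < length π → σ ≢ π → σ ≢ ρ →
  (∀ {τ} → σ ≼ τ → τ ≼ π → length τ < length π → ¬ τ ≼ ρ → μ σ τ ≡ 0ℤ) →
  μ σ π ≡ 0ℤ
zero-by-cut σ π ρ std-ρ ρ≼π ρ<π σ≢π σ≢ρ outside-zero with σ ∈ₗ? patterns π
... | no σ⋠π = μ-outside σ π σ≢π σ⋠π
... | yes σ≼π = begin
  μ σ π                                 ≡⟨ μ-unfold σ π σ≢π σ≼π ⟩
  - sumℤ (map (μ σ) (halfOpen σ π))     ≡⟨ cong -_ (sumℤ-drop-zeros (_∈ₗ? patterns ρ) (μ σ) (halfOpen σ π) cut-zero) ⟩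
  - sumℤ (map (μ σ) (filter (_∈ₗ? patterns ρ) (halfOpen σ π))) ≡⟨ cong -_ below-ρ ⟩
  - 0ℤ                                  ∎
  where
  open ≡-Reasoning
  cut-zero : ∀ {τ} → τ ∈ halfOpen σ π → ¬ τ ≼ ρ → μ σ τ ≡ 0ℤ
  cut-zero τ∈ with halfOpen⁻ σ π τ∈
  ... | σ≼τ , τ≼π , τ<π = outside-zero σ≼τ τ≼π τ<π
  below-ρ : sumℤ (map (μ σ) (filter (_∈ₗ? patterns ρ) (halfOpen σ π))) ≡ 0ℤ
  below-ρ with σ ∈ₗ? patterns ρ
  ... | yes σ≼ρ = trans (sumℤ-↭ (Perm.map⁺ (μ σ) (halfOpen-cut σ π ρ std-ρ ρ≼π ρ<π σ≼ρ)))
                        (closed-interval-sum σ ρ σ≢ρ σ≼ρ)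
  ... | no σ⋠ρ = cong (λ z → sumℤ (map (μ σ) z)) (filter-none (_∈ₗ? patterns ρ)
                   (All.tabulate (λ {τ} τ∈ τ≼ρ → σ⋠ρ (≼-trans {σ} {τ} {ρ} (proj₁ (halfOpen⁻ σ π τ∈)) τ≼ρ))))

std-single : ∀ x → std (x ∷ []) ≡ one
std-single x = cong (λ z → suc z ∷ []) (below-none (x ∷ []) (λ { (here refl) → n≮n x }))

one-≼ : ∀ π → 1 ≤ length π → one ≼ π
one-≼ (x ∷ π) _ = subst (_≼ (x ∷ π)) (std-single x) (pattern⁺ {π = x ∷ π} (refl ∷ Sublist.[]⊆-universal π))

one-copy : ∀ π → 1 ≤ length π → HasIntervalCopy π one
one-copy (x ∷ π) _ = subst (HasIntervalCopy (x ∷ π)) (std-single x)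
  (interval-copy [] (x ∷ []) π (s≤s z≤n) (x , subst (λ z → x ∷ [] ↭ z ∷ []) (sym (+-identityʳ x)) ↭-refl))

perm-length-one : ∀ φ → IsPerm φ → length φ ≡ 1 → φ ≡ one
perm-length-one (x ∷ []) p _ with ∈-resp-↭ p (here refl)
... | here refl = refl

copy-distinguishes : ∀ {σ ρ ψ} → ¬ HasIntervalCopy σ ψ → HasIntervalCopy ρ ψ → σ ≢ ρ
copy-distinguishes no-copy copy refl = no-copy copy

-- A σ-core of a permutation φ not interval-contained in a non-empty σ is
-- non-empty: otherwise φ = 1, of which σ has interval copies.
core-nonempty : ∀ {σ φ : List ℕ} (φ⁻ : List ℕ) → 1 ≤ length σ → IsPerm φ → ¬ HasIntervalCopy σ φ →
  suc (length φ⁻) ≡ length φ → 1 ≤ length φ⁻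
core-nonempty {σ} {φ} [] σ-nonempty φ-perm no-copy one-longer =
  ⊥-elim (no-copy (subst (HasIntervalCopy σ) (sym (perm-length-one φ φ-perm (sym one-longer))) (one-copy σ σ-nonempty)))
core-nonempty (_ ∷ _) _ _ _ _ = s≤s z≤n

-- The permutations of [1, φ) ∖ [1, φ⁻]: those a σ-core φ⁻ declares σ-annihilators.
OutsideCore : List ℕ → List ℕ → List ℕ → Set
OutsideCore φ φ⁻ ψ = IsPerm ψ × one ≼ ψ × ψ ≺ φ × ¬ (one ≼ ψ × ψ ≼ φ⁻)

unique-disjoint : ∀ (a : List ℕ) {b : List ℕ} {x : ℕ} → Unique (a ++ b) → x ∈ a → x ∈ b → ⊥
unique-disjoint (y ∷ a) (y∉ ∷ u) (here refl) x∈b = All.lookup y∉ (∈-++⁺ʳ a x∈b) refl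
unique-disjoint (y ∷ a) (_ ∷ u) (there x∈a) x∈b = unique-disjoint a u x∈a x∈b

nonempty-if-⋠ : ∀ (x ρ : List ℕ) → ¬ std x ≼ ρ → 1 ≤ length x
nonempty-if-⋠ [] ρ x⋠ρ = ⊥-elim (x⋠ρ (pattern⁺ {π = ρ} (Sublist.[]⊆-universal ρ)))
nonempty-if-⋠ (_ ∷ _) _ _ = s≤s z≤n

module CoreInWindow (φ φ⁻ A w C : List ℕ) (lo : ℕ) (distinct : Unique (A ++ w ++ C))
  (values : w ↭ block lo (length w)) (shape : std w ≡ φ)
  (φ⁻≼φ : φ⁻ ≼ φ) (one-longer : suc (length φ⁻) ≡ length φ) where

  open ValueWindow lo (length w)

  π : List ℕ
  π = A ++ w ++ C

  w-inside : Inside w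
  w-inside v∈ = block⁻ (∈-resp-↭ values v∈)

  -- Every value of the window occurs in w, hence nowhere else in π.
  window-in-w : ∀ {v} → InWindow lo (length w) v → v ∈ w
  window-in-w (lo≤v , v<) = ∈-resp-↭ (↭-sym values) (block⁺ lo≤v v<)

  A-outside : Outside A
  A-outside v∈A v-in = unique-disjoint A distinct v∈A (∈-++⁺ˡ (window-in-w v-in))

  C-outside : Outside C
  C-outside v∈C v-in = unique-disjoint w (Unique-⊆ (Sublist.++⁺ˡ A ⊆-refl) distinct) (window-in-w v-in) v∈C

  w-unique : Unique w
  w-unique = Unique-⊆ (Sublist.++⁺ˡ A (Sublist.++⁺ʳ C ⊆-refl)) distinct

  pattern-split : ∀ {τ} → τ ≼ π → ∃₂ λ a x → ∃ λ c → a ⊆ A × x ⊆ w × c ⊆ C × τ ≡ std (a ++ x ++ c)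
  pattern-split τ≼π with pattern⁻ π τ≼π
  ... | s , s⊆π , refl with ⊆-++⁻ A s⊆π
  ... | a , s′ , a⊆ , s′⊆ , refl with ⊆-++⁻ w s′⊆
  ... | x , c , x⊆ , c⊆ , refl = a , x , c , a⊆ , x⊆ , c⊆ , refl

  choice-copy : ∀ {a x c} → a ⊆ A → x ⊆ w → c ⊆ C → 1 ≤ length x →
    HasIntervalCopy (std (a ++ x ++ c)) (std x)
  choice-copy {a} {x} {c} a⊆ x⊆ c⊆ = inside-copy a x c
    (λ v∈ → w-inside (lookup x⊆ v∈)) (λ v∈ → A-outside (lookup a⊆ v∈)) (λ v∈ → C-outside (lookup c⊆ v∈))
    (Unique-⊆ x⊆ w-unique)

  core-in-w : ∃ λ x⁻ → x⁻ ⊆ w × φ⁻ ≡ std x⁻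
  core-in-w with pattern⁻ φ φ⁻≼φ
  ... | s , s⊆φ , refl with ⊆-std⁻ (subst (s ⊆_) (sym shape) s⊆φ)
  ... | x⁻ , x⁻⊆w , same = x⁻ , x⁻⊆w , same

  x⁻ : List ℕ
  x⁻ = proj₁ core-in-w

  x⁻⊆w : x⁻ ⊆ w
  x⁻⊆w = proj₁ (proj₂ core-in-w)

  π⁻ : List ℕ
  π⁻ = std (A ++ x⁻ ++ C)

  shrunk⊆π : A ++ x⁻ ++ C ⊆ π
  shrunk⊆π = Sublist.++⁺ (⊆-refl {A}) (Sublist.++⁺ x⁻⊆w (⊆-refl {C}))

  π⁻≼π : π⁻ ≼ π
  π⁻≼π = pattern⁺ shrunk⊆π

  π⁻-shorter : length π⁻ < length π
  π⁻-shorter = begin-strict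
    length (std (A ++ x⁻ ++ C))            ≡⟨ length-std (A ++ x⁻ ++ C) ⟩
    length (A ++ x⁻ ++ C)                  ≡⟨ length-++ A ⟩
    length A + length (x⁻ ++ C)            ≡⟨ cong (length A +_) (length-++ x⁻) ⟩
    length A + (length x⁻ + length C)      <⟨ +-monoʳ-< (length A) (+-monoˡ-< (length C) x⁻-shorter) ⟩
    length A + (length w + length C)       ≡⟨ cong (length A +_) (length-++ w) ⟨
    length A + length (w ++ C)             ≡⟨ length-++ A ⟨
    length π                               ∎
    where
    open ≤-Reasoning
    x⁻-shorter : length x⁻ < length w
    x⁻-shorter = subst₂ (λ m n → suc m ≤ n)
      (trans (cong length (proj₂ (proj₂ core-in-w))) (length-std x⁻))
      (trans (cong length (sym shape)) (length-std w))
      (≤-reflexive one-longer)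

  π⁻-copy : 1 ≤ length φ⁻ → HasIntervalCopy π⁻ φ⁻
  π⁻-copy nonempty = subst (HasIntervalCopy π⁻) (sym (proj₂ (proj₂ core-in-w)))
    (choice-copy ⊆-refl x⁻⊆w ⊆-refl (subst (1 ≤_) (trans (cong length (proj₂ (proj₂ core-in-w))) (length-std x⁻)) nonempty))

  -- If the part in w has a pattern inside φ⁻, the whole choice lies below π⁻:
  -- replace that part by an equally shaped sublist of x⁻.
  below-π⁻ : ∀ {a x c} → a ⊆ A → x ⊆ w → c ⊆ C → std x ≼ φ⁻ → std (a ++ x ++ c) ≼ π⁻
  below-π⁻ {a} {x} {c} a⊆ x⊆ c⊆ x≼φ⁻
    with pattern⁻ (std x⁻) (subst (std x ≼_) (proj₂ (proj₂ core-in-w)) x≼φ⁻)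
  ... | s , s⊆ , x~s with ⊆-std⁻ s⊆
  ... | x′ , x′⊆x⁻ , s~x′ = subst (_≼ π⁻)
        (std-replace a x′ x c (λ v∈ → w-inside (lookup x⁻⊆w (lookup x′⊆x⁻ v∈))) (λ v∈ → w-inside (lookup x⊆ v∈))
           (λ v∈ → A-outside (lookup a⊆ v∈)) (λ v∈ → C-outside (lookup c⊆ v∈)) (sym (trans x~s s~x′)))
        (std-⊆ {L = A ++ x⁻ ++ C} (Sublist.++⁺ a⊆ (Sublist.++⁺ x′⊆x⁻ c⊆)))

  -- The key observation: a pattern of π outside π⁻ uses either all of w, and then
  -- has an interval copy of φ, or a part of w whose pattern lies in [1, φ) ∖ [1, φ⁻],
  -- and then has an interval copy of that pattern.
  classify : ∀ {τ} → τ ≼ π → ¬ τ ≼ π⁻ →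
    HasIntervalCopy τ φ ⊎ ∃ λ ψ → OutsideCore φ φ⁻ ψ × HasIntervalCopy τ ψ
  classify τ≼π τ⋠π⁻ with pattern-split τ≼π
  ... | a , x , c , a⊆ , x⊆ , c⊆ , refl with std x ∈ₗ? patterns φ⁻
  ...   | yes x≼φ⁻ = ⊥-elim (τ⋠π⁻ (below-π⁻ a⊆ x⊆ c⊆ x≼φ⁻))
  ...   | no x⋠φ⁻ with m≤n⇒m<n∨m≡n (Sublist.length-mono-≤ x⊆)
  ...     | inj₂ full = inj₁ (subst (HasIntervalCopy _) (trans (cong std (⊆-full x⊆ full)) shape) copy)
    where
    copy : HasIntervalCopy (std (a ++ x ++ c)) (std x)
    copy = choice-copy a⊆ x⊆ c⊆ (nonempty-if-⋠ x φ⁻ x⋠φ⁻)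
  ...     | inj₁ proper = inj₂ (std x , outside-core , choice-copy a⊆ x⊆ c⊆ nonempty)
    where
    nonempty : 1 ≤ length x
    nonempty = nonempty-if-⋠ x φ⁻ x⋠φ⁻
    ψ≢φ : std x ≢ φ
    ψ≢φ ψ≡φ = <-irrefl (trans (sym (length-std x)) (trans (cong length (trans ψ≡φ (sym shape))) (length-std w))) proper
    outside-core : OutsideCore φ φ⁻ (std x)
    outside-core = std-perm x (Unique-⊆ x⊆ w-unique) ,
      one-≼ (std x) (subst (1 ≤_) (sym (length-std x)) nonempty) ,
      (subst (std x ≼_) shape (std-⊆ x⊆) , ψ≢φ) ,
      (λ below → x⋠φ⁻ (proj₂ below))

proposition4p1 : (σ φ φ⁻ : List ℕ) → IsPerm σ → 1 ≤ length σ →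
    IsPerm φ → IsCore σ φ φ⁻ →
    ¬ HasIntervalCopy σ φ → ¬ HasIntervalCopy σ φ⁻ →
    Annihilator σ φ
proposition4p1 σ φ φ⁻ _ σ-nonempty φ-perm (_ , one-longer , φ⁻≼φ , annihilators) no-φ no-φ⁻ π π-perm copy =
  annihilates (suc (length π)) π (n<1+n _) π-perm copy
  where
  annihilates : ∀ n π → length π < n → IsPerm π → HasIntervalCopy π φ → IsZero σ π
  annihilates (suc n) π π<n π-perm copy with interval-split copy
  ... | A , w , C , lo , refl , values , shape =
    zero-by-cut σ π π⁻ (std-idem _) π⁻≼π π⁻-shorter
      (copy-distinguishes no-φ copy)
      (copy-distinguishes no-φ⁻ (π⁻-copy (core-nonempty φ⁻ σ-nonempty φ-perm no-φ one-longer)))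
      (λ _ τ≼π τ<π τ⋠π⁻ → zero-outside-π⁻ (pattern-perm (perm-unique π-perm) τ≼π)
                                 (≤-trans τ<π (≤-pred π<n)) (classify τ≼π τ⋠π⁻))
    where
    open CoreInWindow φ φ⁻ A w C lo (perm-unique π-perm) values shape φ⁻≼φ one-longer hiding (π)
    zero-outside-π⁻ : ∀ {τ} → IsPerm τ → length τ < n →
      HasIntervalCopy τ φ ⊎ (∃ λ ψ → OutsideCore φ φ⁻ ψ × HasIntervalCopy τ ψ) → IsZero σ τ
    zero-outside-π⁻ τ-perm τ<n (inj₁ copy-φ) = annihilates n _ τ<n τ-perm copy-φ
    zero-outside-π⁻ τ-perm _ (inj₂ (ψ , (ψ-perm , one≼ψ , ψ≺φ , ψ∉core) , copy-ψ)) =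
      annihilators ψ ψ-perm one≼ψ ψ≺φ ψ∉core _ τ-perm copy-ψ
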